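{- Let $t\ge3$ and let $r$ be an integer with $t/2\le r\le t$. Let $H_t$ be the binary Hamming code of length $2^t-1$ and $H'_t$ the extended Hamming code of length $2^t$. Then $H'_t$ is $\mathbb{Z}_2\mathbb{Z}_2[u]$-linear with parameters $(2^r,2^{t-1}-2^{r-1})$, the simplex code $H_t^\perp$ is $\mathbb{Z}_2\mathbb{Z}_2[u]$-linear with parameters $(2^r-1,2^{t-1}-2^{r-1})$, and the linear Hadamard code $(H'_t)^\perp$ is $\mathbb{Z}_2\mathbb{Z}_2[u]$-linear with parameters $(2^r,2^{t-1}-2^{r-1})$.
   Context: The binary Hamming code $H_t$ of length $2^t-1$ is the binary linear code whose parity-check matrix has as columns all nonzero vectors of $\mathbb{Z}_2^t$; $H'_t$ is obtained by appending an overall parity-check coordinate; $^\perp$ denotes the standard binary dual. Let $\mathbb{Z}_2[u]=\{0,1,u,1+u\}$ be the ring with $u^2=0$, $\pi:\mathbb{Z}_2[u]\to\mathbb{Z}_2$ with $\pi(0)=\pi(u)=0$, $\pi(1)=\pi(1+u)=1$. $\mathbb{Z}_2^\alpha\times\mathbb{Z}_2[u]^\beta$ is a $\mathbb{Z}_2[u]$-module with componentwise addition and scalar multiplication $\lambda(x_1,\dots,x_\alpha\mid x'_1,\dots,x'_\beta)=(\pi(\lambda)x_1,\dots,\pi(\lambda)x_\alpha\mid\lambda x'_1,\dots,\lambda x'_\beta)$; a $\mathbb{Z}_2\mathbb{Z}_2[u]$-additive code with parameters $(\alpha,\beta)$ is a $\mathbb{Z}_2[u]$-submodule of it. $\psi:\mathbb{Z}_2[u]\to\mathbb{Z}_2^2$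 is $\psi(0)=(0,0)$, $\psi(1)=(0,1)$, $\psi(u)=(1,1)$, $\psi(1+u)=(1,0)$, extended coordinatewise, and $\Psi(x\mid x')=(x\mid\psi(x'))$. A binary code $C$ of length $\alpha+2\beta$ is $\mathbb{Z}_2\mathbb{Z}_2[u]$-linear with parameters $(\alpha,\beta)$ if, after a suitable permutation of coordinates, $C=\Psi(\mathcal{C})$ for a $\mathbb{Z}_2\mathbb{Z}_2[u]$-additive code $\mathcal{C}$ with parameters $(\alpha,\beta)$. -}

module Defs where

open import Data.Bool using (Bool; true; false; _xor_; _∧_)
open import Data.Nat using (ℕ; zero; suc; _+_; _*_; _∸_; _^_; _/_; _%_; _≡ᵇ_)
open import Data.Fin using (Fin; toℕ) renaming (zero to fzero; suc to fsuc)
open import Data.Vec using (Vec; []; _∷_; _++_; concat; map; zipWith; replicate; foldr; lookup; tabulate)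
open import Data.Fin.Permutation using (Permutation; _⟨$⟩ˡ_)
open import Data.Product using (Σ; _×_; _,_; ∃)
open import Relation.Binary.PropositionalEquality using (_≡_)
open import Function.Bundles using (_⇔_)

-- Binary words and binary codes (a code of length n is a set of words,
-- represented as a predicate on Vec Bool n; Bool = Z_2, xor = +, ∧ = ·).

Word : ℕ → Set
Word n = Vec Bool n

Code : ℕ → Set₁
Code n = Word n → Set

_⊕_ : ∀ {n} → Word n → Word n → Word n
_⊕_ = zipWith _xor_

parity : ∀ {n} → Word n → Bool
parity = foldr _ _xor_ false

_·_ : ∀ {n} → Word n → Word n → Bool
x · y = parity (zipWith _∧_ x y)

Dual : ∀ {n} → Code n → Code n
Dual C y = ∀ x → C x → x · y ≡ false

-- t-bit binary representation of k (least significant bit first)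
bits : (t : ℕ) → ℕ → Word t
bits zero    k = []
bits (suc t) k = (k % 2 ≡ᵇ 1) ∷ bits t (k / 2)

-- Parity-check matrix of H_t, given by its columns: column j is the binary
-- representation of j+1, so the columns are exactly the nonzero vectors of
-- Z_2^t, each once (j ranges over 0 .. 2^t - 2).
hammingColumn : (t : ℕ) → Fin (2 ^ t ∸ 1) → Word t
hammingColumn t j = bits t (suc (toℕ j))

syndrome : ∀ {n t} → (Fin n → Word t) → Word n → Word t
syndrome {zero}  cols []      = replicate _ false
syndrome {suc n} cols (b ∷ x) =
  zipWith _xor_ (map (b ∧_) (cols fzero)) (syndrome (λ j → cols (fsuc j)) x)

Hamming : (t : ℕ) → Code (2 ^ t ∸ 1)
Hamming t x = syndrome (hammingColumn t) x ≡ replicate t false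

ExtHamming : (t : ℕ) → Code (suc (2 ^ t ∸ 1))
ExtHamming t (p ∷ x) = Hamming t x × p ≡ parity x

data Z2u : Set where
  𝟎 𝟏 𝐮 𝟏+𝐮 : Z2u

toPair : Z2u → Bool × Bool
toPair 𝟎   = false , false
toPair 𝟏   = true  , false
toPair 𝐮   = false , true
toPair 𝟏+𝐮 = true  , true

fromPair : Bool × Bool → Z2u
fromPair (false , false) = 𝟎
fromPair (true  , false) = 𝟏
fromPair (false , true)  = 𝐮
fromPair (true  , true)  = 𝟏+𝐮

_+ᵤ_ : Z2u → Z2u → Z2u
x +ᵤ y with toPair x | toPair y
... | a , b | c , d = fromPair (a xor c , b xor d)

-- (a + b u)(c + d u) = ac + (ad + bc) u
_*ᵤ_ : Z2u → Z2u → Z2u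
x *ᵤ y with toPair x | toPair y
... | a , b | c , d = fromPair (a ∧ c , (a ∧ d) xor (b ∧ c))

π : Z2u → Bool
π 𝟎   = false
π 𝐮   = false
π 𝟏   = true
π 𝟏+𝐮 = true

Elem : ℕ → ℕ → Set
Elem α β = Vec Bool α × Vec Z2u β

zeroE : ∀ {α β} → Elem α β
zeroE = replicate _ false , replicate _ 𝟎

_+ₑ_ : ∀ {α β} → Elem α β → Elem α β → Elem α β
(x , x') +ₑ (y , y') = zipWith _xor_ x y , zipWith _+ᵤ_ x' y'

_•_ : ∀ {α β} → Z2u → Elem α β → Elem α β
λ' • (x , x') = map (π λ' ∧_) x , map (λ' *ᵤ_) x'

record IsAdditive {α β : ℕ} (𝒞 : Elem α β → Set) : Set where
  field
    has-zero  : 𝒞 zeroE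
    +-closed  : ∀ {x y} → 𝒞 x → 𝒞 y → 𝒞 (x +ₑ y)
    •-closed  : ∀ λ' {x} → 𝒞 x → 𝒞 (λ' • x)

ψ : Z2u → Vec Bool 2
ψ 𝟎   = false ∷ false ∷ []
ψ 𝟏   = false ∷ true  ∷ []
ψ 𝐮   = true  ∷ true  ∷ []
ψ 𝟏+𝐮 = true  ∷ false ∷ []

Ψ : ∀ {α β} → Elem α β → Word (α + β * 2)
Ψ (x , x') = x ++ concat (map ψ x')

permute : ∀ {n m} → Permutation n m → Word n → Word m
permute σ x = tabulate (λ i → lookup x (σ ⟨$⟩ˡ i))

-- C (length n) is Z_2Z_2[u]-linear with parameters (α, β):
-- there is a coordinate permutation (a bijection Fin n ↔ Fin (α + 2β), which
-- forces n = α + 2β) and an additive code 𝒞 with σ(C) = Ψ(𝒞).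
IsZ2Z2uLinear : ∀ {n} → Code n → ℕ → ℕ → Set₁
IsZ2Z2uLinear {n} C α β =
  Σ (Permutation n (α + β * 2)) λ σ →
  Σ (Elem α β → Set) λ 𝒞 →
    IsAdditive 𝒞 ×
    (∀ x → C x ⇔ (Σ (Elem α β) λ y → 𝒞 y × permute σ x ≡ Ψ y))

module Submission where

-- A binary code is Z₂Z₂[u]-linear with parameters (α, β) as soon as, after a coordinate
-- permutation, it is linear and closed under the binary image U of multiplication by u, which
-- zeroes the first α coordinates and replaces each of the β remaining pairs (a, b) by (a+b, a+b).
-- U is self-adjoint, so this closure passes to the dual code, and for a code cut out by check
-- words it suffices that U sends every check word to 0 or to a check word.
--
-- Label the coordinates of H′_t by the vectors of Z₂ᵗ and take a linear N on Z₂ᵗ with N² = 0,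
-- made of t − r Jordan blocks of size 2 (possible iff r ≤ t ≤ 2r), so that ker N has 2ʳ elements
-- and every row of N is zero or a unit vector. Put ker N on the α = 2ʳ single positions and pair
-- every other vector v with v + N v. Then U sends the check word v ↦ vᵢ to v ↦ (N v)ᵢ, which is
-- zero or again a check word, and kills the all-ones word. The zero vector lies in ker N, so
-- deleting its coordinate handles H_t in the same way.

open import Defs
open import Data.Nat using (ℕ; _≤_; _*_; _^_; _∸_; zero; suc; _+_; _<_; _/_; _%_; _≡ᵇ_; s≤s; z≤n; s≤s⁻¹)
open import Data.Product using (_×_; Σ; ∃; _,_)

open import Algebra.Bundles using (CommutativeRing)
import Algebra.Properties.CommutativeMonoid.Sum as MonoidSum
import Algebra.Properties.CommutativeSemigroup as CommutativeSemigroupProperties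
open import Data.Bool using (Bool; true; false; _xor_; _∧_)
open import Data.Bool.Properties
  using (xor-same; xor-assoc; xor-identityˡ; xor-identityʳ; ∧-comm; ∧-zeroʳ; ∧-identityʳ; ∧-distribʳ-xor;
         xor-∧-commutativeRing)
open import Data.Empty using (⊥)
open import Data.Fin using (Fin; toℕ; fromℕ<; _↑ˡ_; _↑ʳ_; combine)
import Data.Fin as Fin
open import Data.Fin.Patterns using (0F; 1F)
open import Data.Fin.Permutation
  using (Permutation; _⟨$⟩ʳ_; _⟨$⟩ˡ_; flip; inverseˡ; inverseʳ; remove; lift₀-remove)
open import Data.Fin.Properties using (toℕ-fromℕ<; toℕ-injective; toℕ<n; 0↔⊥; 2↔Bool; +↔⊎; *↔×)
open import Data.Nat.Divisibility using (divides-refl)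
open import Data.Nat.DivMod
  using ([m+kn]%n≡m%n; +-distrib-/-∣ʳ; m*n/n≡m; m≡m%n+[m/n]*n; m<n*o⇒m/o<n; m%n<n)
open import Data.Nat.Properties
  using (+-monoˡ-<; *-monoˡ-≤; *-comm; *-distribˡ-+; *-cancelˡ-≡; +-identityʳ; +-suc; m+n∸n≡m; m≤m+n;
         ≤-refl; ≤-trans; ≤-reflexive; suc-pred; m^n≢0; m≤n⇒m<n∨m≡n; module ≤-Reasoning)
open import Data.Nat.Solver using (module +-*-Solver)
open import Data.Product.Function.NonDependent.Propositional using (_×-↔_)
open import Data.Sum using (_⊎_; inj₁; inj₂)
open import Data.Sum.Function.Propositional using (_⊎-↔_)
open import Data.Vec using (Vec; []; _∷_; _++_; lookup; replicate; tabulate; take; drop; map; zipWith; concat)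
open import Data.Vec.Properties
  using (lookup∘tabulate; tabulate∘lookup; tabulate-cong; lookup-replicate; lookup-zipWith; lookup-map;
         lookup-++ˡ; lookup-++ʳ; take++drop≡id; ∷-injectiveʳ; zipWith-assoc; zipWith-identityˡ;
         zipWith-identityʳ; zipWith-++; map-id; map-const; map-cong)
open import Function.Base using (_∘_)
open import Function.Bundles using (_⇔_; mk⇔; Equivalence; _↔_; mk↔ₛ′; Inverse)
open import Function.Properties.Inverse using (↔-sym; ↔-trans)
open import Relation.Binary.PropositionalEquality

private
  variable
    m n α β : ℕ

open CommutativeRing xor-∧-commutativeRing using (+-commutativeMonoid; +-commutativeSemigroup)
open MonoidSum +-commutativeMonoid using (sum; sum-cong-≗; sum-permute)
open CommutativeSemigroupProperties +-commutativeSemigroup using (interchange)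
open +-*-Solver using (solve; _:*_; _:+_; _:=_; con)

-- Binary words and coordinate permutations

zeros : Word n
zeros = replicate _ false

ones : Word n
ones = replicate _ true

lookup-extensionality : {x y : Vec Bool n} → (∀ i → lookup x i ≡ lookup y i) → x ≡ y
lookup-extensionality {x = x} {y} eq =
  trans (sym (tabulate∘lookup x)) (trans (tabulate-cong eq) (tabulate∘lookup y))

tabulate-const : ∀ (b : Bool) → tabulate {n = n} (λ _ → b) ≡ replicate n b
tabulate-const b = lookup-extensionality λ i → trans (lookup∘tabulate _ i) (sym (lookup-replicate i b))

zeros-++ : zeros {m} ++ zeros {n} ≡ zeros
zeros-++ {zero}  = refl
zeros-++ {suc m} = cong (false ∷_) (zeros-++ {m})

drop-++ : ∀ (x : Vec Bool m) (y : Vec Bool n) → drop m (x ++ y) ≡ y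
drop-++ []      y = refl
drop-++ (b ∷ x) y = drop-++ x y

lookup-↑ʳ-drop : ∀ m (w : Word (m + n)) i → lookup w (m ↑ʳ i) ≡ lookup (drop m w) i
lookup-↑ʳ-drop m w i =
  trans (cong (λ v → lookup v (m ↑ʳ i)) (sym (take++drop≡id m w))) (lookup-++ʳ (take m w) (drop m w) i)

map≡zipWith-map : ∀ {A : Set} {f h : A → A} {g : A → A → A} →
  (∀ a → f a ≡ g a (h a)) → ∀ (x : Vec A n) → map f x ≡ zipWith g x (map h x)
map≡zipWith-map f≡ []      = refl
map≡zipWith-map f≡ (a ∷ x) = cong₂ _∷_ (f≡ a) (map≡zipWith-map f≡ x)

⊕-assoc : ∀ (x y z : Word n) → (x ⊕ y) ⊕ z ≡ x ⊕ (y ⊕ z)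
⊕-assoc = zipWith-assoc xor-assoc

⊕-identityˡ : ∀ (x : Word n) → zeros ⊕ x ≡ x
⊕-identityˡ = zipWith-identityˡ xor-identityˡ

⊕-identityʳ : ∀ (x : Word n) → x ⊕ zeros ≡ x
⊕-identityʳ = zipWith-identityʳ xor-identityʳ

⊕-self : ∀ (x : Word n) → x ⊕ x ≡ zeros
⊕-self []      = refl
⊕-self (a ∷ x) = cong₂ _∷_ (xor-same a) (⊕-self x)

⊕-cancelˡ : ∀ (x y : Word n) → x ⊕ (x ⊕ y) ≡ y
⊕-cancelˡ x y = trans (sym (⊕-assoc x x y)) (trans (cong (_⊕ y) (⊕-self x)) (⊕-identityˡ y))

⊕-cancelʳ : ∀ (x y : Word n) → (x ⊕ y) ⊕ y ≡ x
⊕-cancelʳ x y = trans (⊕-assoc x y y) (trans (cong (x ⊕_) (⊕-self y)) (⊕-identityʳ x))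

·-comm : ∀ (x y : Word n) → x · y ≡ y · x
·-comm []      []      = refl
·-comm (a ∷ x) (b ∷ y) = cong₂ _xor_ (∧-comm a b) (·-comm x y)

·-distribʳ-⊕ : ∀ (x y z : Word n) → (x ⊕ y) · z ≡ (x · z) xor (y · z)
·-distribʳ-⊕ []      []      []      = refl
·-distribʳ-⊕ (a ∷ x) (b ∷ y) (c ∷ z) =
  trans (cong₂ _xor_ (∧-distribʳ-xor c a b) (·-distribʳ-⊕ x y z))
        (interchange (a ∧ c) (b ∧ c) (x · z) (y · z))

·-distribˡ-⊕ : ∀ (x y z : Word n) → z · (x ⊕ y) ≡ (z · x) xor (z · y)
·-distribˡ-⊕ x y z =
  trans (·-comm z (x ⊕ y)) (trans (·-distribʳ-⊕ x y z) (cong₂ _xor_ (·-comm x z) (·-comm y z)))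

·-zeroʳ : ∀ (x : Word n) → x · zeros ≡ false
·-zeroʳ []      = refl
·-zeroʳ (a ∷ x) = cong₂ _xor_ (∧-zeroʳ a) (·-zeroʳ x)

·-zeroˡ : ∀ (x : Word n) → zeros · x ≡ false
·-zeroˡ []      = refl
·-zeroˡ (a ∷ x) = ·-zeroˡ x

·-onesʳ : ∀ (x : Word n) → x · ones ≡ parity x
·-onesʳ []      = refl
·-onesʳ (a ∷ x) = cong₂ _xor_ (∧-identityʳ a) (·-onesʳ x)

·-++ : ∀ (x z : Word m) (y w : Word n) → (x ++ y) · (z ++ w) ≡ (x · z) xor (y · w)
·-++ []      []      y w = refl
·-++ (a ∷ x) (c ∷ z) y w = trans (cong ((a ∧ c) xor_) (·-++ x z y w)) (sym (xor-assoc (a ∧ c) (x · z) (y · w)))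

·-as-sum : ∀ (x y : Word n) → x · y ≡ sum (λ i → lookup x i ∧ lookup y i)
·-as-sum []      []      = refl
·-as-sum (a ∷ x) (b ∷ y) = cong ((a ∧ b) xor_) (·-as-sum x y)

module _ (σ : Permutation n m) where

  lookup-permute : ∀ (x : Word n) p → lookup (permute σ x) p ≡ lookup x (σ ⟨$⟩ˡ p)
  lookup-permute x p = lookup∘tabulate _ p

  permute-⊕ : ∀ (x y : Word n) → permute σ (x ⊕ y) ≡ permute σ x ⊕ permute σ y
  permute-⊕ x y = lookup-extensionality λ p → begin
    lookup (permute σ (x ⊕ y)) p                ≡⟨ lookup-permute (x ⊕ y) p ⟩
    lookup (x ⊕ y) (σ ⟨$⟩ˡ p)                   ≡⟨ lookup-zipWith _xor_ (σ ⟨$⟩ˡ p) x y ⟩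
    lookup x (σ ⟨$⟩ˡ p) xor lookup y (σ ⟨$⟩ˡ p) ≡⟨ cong₂ _xor_ (lookup-permute x p) (lookup-permute y p) ⟨
    lookup (permute σ x) p xor lookup (permute σ y) p ≡⟨ lookup-zipWith _xor_ p (permute σ x) (permute σ y) ⟨
    lookup (permute σ x ⊕ permute σ y) p        ∎
    where open ≡-Reasoning

  permute-replicate : ∀ b → permute σ (replicate n b) ≡ replicate m b
  permute-replicate b = lookup-extensionality λ p →
    trans (lookup-permute (replicate n b) p) (trans (lookup-replicate (σ ⟨$⟩ˡ p) b) (sym (lookup-replicate p b)))

  permute-inverseˡ : ∀ (x : Word n) → permute (flip σ) (permute σ x) ≡ x
  permute-inverseˡ x = lookup-extensionality λ i →
    trans (lookup∘tabulate _ i) (trans (lookup-permute x (σ ⟨$⟩ʳ i)) (cong (lookup x) (inverseˡ σ)))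

  permute-inverseʳ : ∀ (z : Word m) → permute σ (permute (flip σ) z) ≡ z
  permute-inverseʳ z = lookup-extensionality λ p →
    trans (lookup-permute (permute (flip σ) z) p) (trans (lookup∘tabulate _ (σ ⟨$⟩ˡ p)) (cong (lookup z) (inverseʳ σ)))

  ·-permute : ∀ (x y : Word n) → permute σ x · permute σ y ≡ x · y
  ·-permute x y = begin
    permute σ x · permute σ y                              ≡⟨ ·-as-sum (permute σ x) (permute σ y) ⟩
    sum (λ p → lookup (permute σ x) p ∧ lookup (permute σ y) p)
      ≡⟨ sum-cong-≗ (λ p → cong₂ _∧_ (lookup-permute x p) (lookup-permute y p)) ⟩
    sum (λ p → lookup x (σ ⟨$⟩ˡ p) ∧ lookup y (σ ⟨$⟩ˡ p))
      ≡⟨ sum-permute (λ i → lookup x i ∧ lookup y i) (flip σ) ⟨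
    sum (λ i → lookup x i ∧ lookup y i)                   ≡⟨ ·-as-sum x y ⟨
    x · y                                                  ∎
    where open ≡-Reasoning

  ·-permute-flipʳ : ∀ (x : Word n) z → x · permute (flip σ) z ≡ permute σ x · z
  ·-permute-flipʳ x z = trans (sym (·-permute x (permute (flip σ) z))) (cong (permute σ x ·_) (permute-inverseʳ z))

  ·-permute-flipˡ : ∀ (x : Word n) z → permute (flip σ) z · x ≡ z · permute σ x
  ·-permute-flipˡ x z = trans (·-comm _ x) (trans (·-permute-flipʳ x z) (·-comm _ z))

module _ (σ : Permutation (suc n) (suc m)) (σ-0 : σ ⟨$⟩ʳ 0F ≡ 0F) where

  private
    ρ : Permutation n m
    ρ = remove 0F σ

    σʳ-suc : ∀ i → σ ⟨$⟩ʳ Fin.suc i ≡ Fin.suc (ρ ⟨$⟩ʳ i)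
    σʳ-suc i = sym (lift₀-remove σ σ-0 (Fin.suc i))

    σˡ-0 : σ ⟨$⟩ˡ 0F ≡ 0F
    σˡ-0 = trans (cong (σ ⟨$⟩ˡ_) (sym σ-0)) (inverseˡ σ)

    σˡ-suc : ∀ p → σ ⟨$⟩ˡ Fin.suc p ≡ Fin.suc (ρ ⟨$⟩ˡ p)
    σˡ-suc p =
      trans (cong (σ ⟨$⟩ˡ_) (sym (trans (σʳ-suc (ρ ⟨$⟩ˡ p)) (cong Fin.suc (inverseʳ ρ))))) (inverseˡ σ)

  permute-remove : ∀ b (x : Word n) → permute σ (b ∷ x) ≡ b ∷ permute ρ x
  permute-remove b x =
    cong₂ _∷_ (cong (lookup (b ∷ x)) σˡ-0) (tabulate-cong λ p → cong (lookup (b ∷ x)) (σˡ-suc p))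

  permute-flip-remove : ∀ b (w : Word m) → permute (flip σ) (b ∷ w) ≡ b ∷ permute (flip ρ) w
  permute-flip-remove b w =
    cong₂ _∷_ (cong (lookup (b ∷ w)) σ-0) (tabulate-cong λ i → cong (lookup (b ∷ w)) (σʳ-suc i))

-- The Gray map and multiplication by u

pairSum : ∀ β → Word (β * 2) → Word (β * 2)
pairSum zero    []          = []
pairSum (suc β) (a ∷ b ∷ w) = (a xor b) ∷ (a xor b) ∷ pairSum β w

uMul : ∀ α β → Word (α + β * 2) → Word (α + β * 2)
uMul α β w = zeros {α} ++ pairSum β (drop α w)

xor-∧-pair-adjoint : ∀ a b c d e →
  ((a xor b) ∧ c) xor (((a xor b) ∧ d) xor e) ≡ (a ∧ (c xor d)) xor ((b ∧ (c xor d)) xor e)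
xor-∧-pair-adjoint false false c d e = refl
xor-∧-pair-adjoint false true  c d e = sym (xor-assoc c d e)
xor-∧-pair-adjoint true  false c d e = sym (xor-assoc c d e)
xor-∧-pair-adjoint true  true  c d e =
  sym (trans (sym (xor-assoc (c xor d) (c xor d) e)) (cong (_xor e) (xor-same (c xor d))))

pairSum-selfAdjoint : ∀ β (x y : Word (β * 2)) → pairSum β x · y ≡ x · pairSum β y
pairSum-selfAdjoint zero    []          []          = refl
pairSum-selfAdjoint (suc β) (a ∷ b ∷ x) (c ∷ d ∷ y) =
  trans (cong (λ e → ((a xor b) ∧ c) xor (((a xor b) ∧ d) xor e)) (pairSum-selfAdjoint β x y))
        (xor-∧-pair-adjoint a b c d (x · pairSum β y))

uMul-selfAdjoint : ∀ α β (x y : Word (α + β * 2)) → uMul α β x · y ≡ x · uMul α β y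
uMul-selfAdjoint α β x y = begin
  uMul α β x · y
    ≡⟨ cong (uMul α β x ·_) (sym (take++drop≡id α y)) ⟩
  (zeros ++ pairSum β (drop α x)) · (take α y ++ drop α y)
    ≡⟨ ·-++ zeros (take α y) (pairSum β (drop α x)) (drop α y) ⟩
  (zeros · take α y) xor (pairSum β (drop α x) · drop α y)
    ≡⟨ cong₂ _xor_ (trans (·-zeroˡ (take α y)) (sym (·-zeroʳ (take α x))))
                   (pairSum-selfAdjoint β (drop α x) (drop α y)) ⟩
  (take α x · zeros) xor (drop α x · pairSum β (drop α y))
    ≡⟨ ·-++ (take α x) zeros (drop α x) (pairSum β (drop α y)) ⟨
  (take α x ++ drop α x) · uMul α β y
    ≡⟨ cong (_· uMul α β y) (take++drop≡id α x) ⟩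
  x · uMul α β y ∎
  where open ≡-Reasoning

lookup-pairSum : ∀ β (w : Word (β * 2)) (q : Fin β) (c : Fin 2) →
  lookup (pairSum β w) (combine q c) ≡ lookup w (combine q 0F) xor lookup w (combine q 1F)
lookup-pairSum (suc β) (a ∷ b ∷ w) 0F      0F = refl
lookup-pairSum (suc β) (a ∷ b ∷ w) 0F      1F = refl
lookup-pairSum (suc β) (a ∷ b ∷ w) (Fin.suc q) c  = lookup-pairSum β w q c

lookup-uMul-↑ˡ : ∀ α β (w : Word (α + β * 2)) i → lookup (uMul α β w) (i ↑ˡ β * 2) ≡ false
lookup-uMul-↑ˡ α β w i = trans (lookup-++ˡ (zeros {α}) (pairSum β (drop α w)) i) (lookup-replicate i false)

lookup-uMul-↑ʳ : ∀ α β (w : Word (α + β * 2)) (q : Fin β) (c : Fin 2) →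
  lookup (uMul α β w) (α ↑ʳ combine q c) ≡ lookup w (α ↑ʳ combine q 0F) xor lookup w (α ↑ʳ combine q 1F)
lookup-uMul-↑ʳ α β w q c = begin
  lookup (uMul α β w) (α ↑ʳ combine q c)
    ≡⟨ lookup-++ʳ (zeros {α}) (pairSum β (drop α w)) (combine q c) ⟩
  lookup (pairSum β (drop α w)) (combine q c)
    ≡⟨ lookup-pairSum β (drop α w) q c ⟩
  lookup (drop α w) (combine q 0F) xor lookup (drop α w) (combine q 1F)
    ≡⟨ cong₂ _xor_ (lookup-↑ʳ-drop α w _) (lookup-↑ʳ-drop α w _) ⟨
  lookup w (α ↑ʳ combine q 0F) xor lookup w (α ↑ʳ combine q 1F) ∎
  where open ≡-Reasoning

ψs : Vec Z2u β → Word (β * 2)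
ψs x′ = concat (map ψ x′)

ψ-+ᵤ : ∀ a b → ψ (a +ᵤ b) ≡ ψ a ⊕ ψ b
ψ-+ᵤ = λ { 𝟎 𝟎 → refl ; 𝟎 𝟏 → refl ; 𝟎 𝐮 → refl ; 𝟎 𝟏+𝐮 → refl
         ; 𝟏 𝟎 → refl ; 𝟏 𝟏 → refl ; 𝟏 𝐮 → refl ; 𝟏 𝟏+𝐮 → refl
         ; 𝐮 𝟎 → refl ; 𝐮 𝟏 → refl ; 𝐮 𝐮 → refl ; 𝐮 𝟏+𝐮 → refl
         ; 𝟏+𝐮 𝟎 → refl ; 𝟏+𝐮 𝟏 → refl ; 𝟏+𝐮 𝐮 → refl ; 𝟏+𝐮 𝟏+𝐮 → refl }

ψs-+ᵤ : ∀ (x′ y′ : Vec Z2u β) → ψs (zipWith _+ᵤ_ x′ y′) ≡ ψs x′ ⊕ ψs y′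
ψs-+ᵤ []       []       = refl
ψs-+ᵤ (a ∷ x′) (b ∷ y′) =
  trans (cong₂ _++_ (ψ-+ᵤ a b) (ψs-+ᵤ x′ y′)) (sym (zipWith-++ _xor_ (ψ a) (ψs x′) (ψ b) (ψs y′)))

ψs-𝐮 : ∀ (x′ : Vec Z2u β) → ψs (map (𝐮 *ᵤ_) x′) ≡ pairSum β (ψs x′)
ψs-𝐮 []         = refl
ψs-𝐮 (𝟎   ∷ x′) = cong (λ w → false ∷ false ∷ w) (ψs-𝐮 x′)
ψs-𝐮 (𝟏   ∷ x′) = cong (λ w → true ∷ true ∷ w) (ψs-𝐮 x′)
ψs-𝐮 (𝐮   ∷ x′) = cong (λ w → false ∷ false ∷ w) (ψs-𝐮 x′)
ψs-𝐮 (𝟏+𝐮 ∷ x′) = cong (λ w → true ∷ true ∷ w) (ψs-𝐮 x′)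

ψs-replicate-𝟎 : ψs (replicate β 𝟎) ≡ zeros
ψs-replicate-𝟎 {zero}  = refl
ψs-replicate-𝟎 {suc β} = cong (λ w → false ∷ false ∷ w) (ψs-replicate-𝟎 {β})

unψ : Bool → Bool → Z2u
unψ false false = 𝟎
unψ false true  = 𝟏
unψ true  true  = 𝐮
unψ true  false = 𝟏+𝐮

ψ-unψ : ∀ a b → ψ (unψ a b) ≡ a ∷ b ∷ []
ψ-unψ false false = refl
ψ-unψ false true  = refl
ψ-unψ true  true  = refl
ψ-unψ true  false = refl

unψs : ∀ β → Word (β * 2) → Vec Z2u β
unψs zero    []          = []
unψs (suc β) (a ∷ b ∷ w) = unψ a b ∷ unψs β w

ψs-unψs : ∀ β (w : Word (β * 2)) → ψs (unψs β w) ≡ w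
ψs-unψs zero    []          = refl
ψs-unψs (suc β) (a ∷ b ∷ w) = cong₂ _++_ (ψ-unψ a b) (ψs-unψs β w)

Ψ-zeroE : Ψ (zeroE {α} {β}) ≡ zeros
Ψ-zeroE {α} {β} = trans (cong (zeros {α} ++_) (ψs-replicate-𝟎 {β})) (zeros-++ {α})

Ψ-+ₑ : ∀ (y z : Elem α β) → Ψ (y +ₑ z) ≡ Ψ y ⊕ Ψ z
Ψ-+ₑ (x , x′) (y , y′) =
  trans (cong ((x ⊕ y) ++_) (ψs-+ᵤ x′ y′)) (sym (zipWith-++ _xor_ x (ψs x′) y (ψs y′)))

Ψ-𝐮 : ∀ (y : Elem α β) → Ψ (𝐮 • y) ≡ uMul α β (Ψ y)
Ψ-𝐮 {β = β} (x , x′) =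
  cong₂ _++_ (map-const x false) (trans (ψs-𝐮 x′) (cong (pairSum β) (sym (drop-++ x (ψs x′)))))

Ψ-surjective : ∀ α β (w : Word (α + β * 2)) → Σ (Elem α β) λ y → Ψ y ≡ w
Ψ-surjective α β w =
  (take α w , unψs β (drop α w)) , trans (cong (take α w ++_) (ψs-unψs β (drop α w))) (take++drop≡id α w)

*ᵤ-zeroˡ : ∀ z → 𝟎 *ᵤ z ≡ 𝟎
*ᵤ-zeroˡ = λ { 𝟎 → refl ; 𝟏 → refl ; 𝐮 → refl ; 𝟏+𝐮 → refl }

*ᵤ-identityˡ : ∀ z → 𝟏 *ᵤ z ≡ z
*ᵤ-identityˡ = λ { 𝟎 → refl ; 𝟏 → refl ; 𝐮 → refl ; 𝟏+𝐮 → refl }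

*ᵤ-𝟏+𝐮 : ∀ z → 𝟏+𝐮 *ᵤ z ≡ z +ᵤ (𝐮 *ᵤ z)
*ᵤ-𝟏+𝐮 = λ { 𝟎 → refl ; 𝟏 → refl ; 𝐮 → refl ; 𝟏+𝐮 → refl }

•-zeroˡ : ∀ (y : Elem α β) → 𝟎 • y ≡ zeroE
•-zeroˡ (x , x′) = cong₂ _,_ (map-const x false) (trans (map-cong *ᵤ-zeroˡ x′) (map-const x′ 𝟎))

•-identityˡ : ∀ (y : Elem α β) → 𝟏 • y ≡ y
•-identityˡ (x , x′) = cong₂ _,_ (map-id x) (trans (map-cong *ᵤ-identityˡ x′) (map-id x′))

•-𝟏+𝐮 : ∀ (y : Elem α β) → 𝟏+𝐮 • y ≡ y +ₑ (𝐮 • y)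
•-𝟏+𝐮 (x , x′) = cong₂ _,_ (map≡zipWith-map (sym ∘ xor-identityʳ) x) (map≡zipWith-map *ᵤ-𝟏+𝐮 x′)

-- Codes closed under u

module UStability {n} α β (σ : Permutation n (α + β * 2)) where

  U : Word n → Word n
  U x = permute (flip σ) (uMul α β (permute σ x))

  U-selfAdjoint : ∀ x y → x · U y ≡ U x · y
  U-selfAdjoint x y = begin
    x · U y                                ≡⟨ ·-permute-flipʳ σ x (uMul α β (permute σ y)) ⟩
    permute σ x · uMul α β (permute σ y)   ≡⟨ uMul-selfAdjoint α β _ _ ⟨
    uMul α β (permute σ x) · permute σ y   ≡⟨ ·-permute-flipˡ σ y (uMul α β (permute σ x)) ⟨
    U x · y                                ∎
    where open ≡-Reasoning

  record IsUStable (C : Code n) : Set where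
    field
      zero∈    : C zeros
      ⊕-closed : ∀ {x y} → C x → C y → C (x ⊕ y)
      U-closed : ∀ {x} → C x → C (U x)

  grayCode : Code n → Elem α β → Set
  grayCode C y = C (permute (flip σ) (Ψ y))

  grayCode-IsAdditive : ∀ {C} → IsUStable C → IsAdditive (grayCode C)
  grayCode-IsAdditive {C} stable = record
    { has-zero = 𝒞-zero
    ; +-closed = λ {y} {z} → 𝒞-+ {y} {z}
    ; •-closed = λ a {y} → 𝒞-• a {y}
    }
    where
    open IsUStable stable

    C′ : Word (α + β * 2) → Set
    C′ w = C (permute (flip σ) w)

    C′-zeros : C′ zeros
    C′-zeros = subst C (sym (permute-replicate (flip σ) false)) zero∈

    C′-⊕ : ∀ {w w′} → C′ w → C′ w′ → C′ (w ⊕ w′)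
    C′-⊕ {w} {w′} cw cw′ = subst C (sym (permute-⊕ (flip σ) w w′)) (⊕-closed cw cw′)

    C′-uMul : ∀ {w} → C′ w → C′ (uMul α β w)
    C′-uMul {w} cw = subst (λ v → C (permute (flip σ) (uMul α β v))) (permute-inverseʳ σ w) (U-closed cw)

    𝒞 : Elem α β → Set
    𝒞 = grayCode C

    𝒞-zero : 𝒞 zeroE
    𝒞-zero = subst C′ (sym (Ψ-zeroE {α} {β})) C′-zeros

    𝒞-+ : ∀ {y z} → 𝒞 y → 𝒞 z → 𝒞 (y +ₑ z)
    𝒞-+ {y} {z} cy cz = subst C′ (sym (Ψ-+ₑ y z)) (C′-⊕ {Ψ y} {Ψ z} cy cz)

    𝒞-𝐮 : ∀ {y} → 𝒞 y → 𝒞 (𝐮 • y)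
    𝒞-𝐮 {y} cy = subst C′ (sym (Ψ-𝐮 y)) (C′-uMul {Ψ y} cy)

    𝒞-• : ∀ a {y} → 𝒞 y → 𝒞 (a • y)
    𝒞-• 𝟎   {y} _  = subst 𝒞 (sym (•-zeroˡ y)) 𝒞-zero
    𝒞-• 𝟏   {y} cy = subst 𝒞 (sym (•-identityˡ y)) cy
    𝒞-• 𝐮   {y} cy = 𝒞-𝐮 {y} cy
    𝒞-• 𝟏+𝐮 {y} cy = subst 𝒞 (sym (•-𝟏+𝐮 y)) (𝒞-+ {y} {𝐮 • y} cy (𝒞-𝐮 {y} cy))

  grayCode-Ψ : ∀ C x → C x ⇔ (Σ (Elem α β) λ y → grayCode C y × permute σ x ≡ Ψ y)
  grayCode-Ψ C x = mk⇔ encode decode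
    where
    encode : C x → Σ (Elem α β) λ y → grayCode C y × permute σ x ≡ Ψ y
    encode cx with Ψ-surjective α β (permute σ x)
    ... | y , Ψy≡σx =
      y , subst C (cong (permute (flip σ)) (sym Ψy≡σx)) (subst C (sym (permute-inverseˡ σ x)) cx) , sym Ψy≡σx

    decode : (Σ (Elem α β) λ y → grayCode C y × permute σ x ≡ Ψ y) → C x
    decode (y , cy , σx≡Ψy) = subst C (permute-inverseˡ σ x) (subst C (cong (permute (flip σ)) (sym σx≡Ψy)) cy)

  IsUStable⇒IsZ2Z2uLinear : ∀ {C} → IsUStable C → IsZ2Z2uLinear C α β
  IsUStable⇒IsZ2Z2uLinear {C} stable = σ , grayCode C , grayCode-IsAdditive stable , grayCode-Ψ C

  IsUStable-Dual : ∀ {C} → IsUStable C → IsUStable (Dual C)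
  IsUStable-Dual stable = record
    { zero∈    = λ x _ → ·-zeroʳ x
    ; ⊕-closed = λ {y} {z} y⊥ z⊥ x cx → trans (·-distribˡ-⊕ y z x) (cong₂ _xor_ (y⊥ x cx) (z⊥ x cx))
    ; U-closed = λ {y} y⊥ x cx → trans (U-selfAdjoint x y) (y⊥ (U x) (U-closed cx))
    }
    where open IsUStable stable

  IsUStable-kernel : ∀ {C : Code n} {I : Set} (R : I → Word n) →
    (∀ x → C x ⇔ (∀ i → x · R i ≡ false)) →
    (∀ i → U (R i) ≡ zeros ⊎ ∃ λ j → U (R i) ≡ R j) →
    IsUStable C
  IsUStable-kernel {C} R C⇔ U-R = record
    { zero∈    = from zeros λ i → ·-zeroˡ (R i)
    ; ⊕-closed = λ {x} {y} cx cy → from (x ⊕ y) λ i →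
        trans (·-distribʳ-⊕ x y (R i)) (cong₂ _xor_ (to x cx i) (to y cy i))
    ; U-closed = λ {x} cx → from (U x) λ i → trans (sym (U-selfAdjoint x (R i))) (⊥-U-R x cx i)
    }
    where
    to : ∀ x → C x → ∀ i → x · R i ≡ false
    to x = Equivalence.to (C⇔ x)

    from : ∀ x → (∀ i → x · R i ≡ false) → C x
    from x = Equivalence.from (C⇔ x)

    ⊥-U-R : ∀ x → C x → ∀ i → x · U (R i) ≡ false
    ⊥-U-R x cx i with U-R i
    ... | inj₁ eq       = trans (cong (x ·_) eq) (·-zeroʳ x)
    ... | inj₂ (j , eq) = trans (cong (x ·_) eq) (to x cx j)

-- Binary representation and Hamming codes

bitValue : Bool → ℕ
bitValue false = 0
bitValue true  = 1

value : ∀ {t} → Word t → ℕ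
value []      = 0
value (b ∷ w) = bitValue b + value w * 2

value<2^ : ∀ {t} (w : Word t) → value w < 2 ^ t
value<2^ []              = s≤s z≤n
value<2^ {suc t} (b ∷ w) = begin-strict
  bitValue b + value w * 2 <⟨ +-monoˡ-< (value w * 2) (bitValue<2 b) ⟩
  suc (value w) * 2        ≤⟨ *-monoˡ-≤ 2 (value<2^ w) ⟩
  2 ^ t * 2                ≡⟨ *-comm (2 ^ t) 2 ⟩
  2 ^ suc t                ∎
  where
  open ≤-Reasoning
  bitValue<2 : ∀ b → bitValue b < 2
  bitValue<2 false = s≤s z≤n
  bitValue<2 true  = s≤s (s≤s z≤n)

bits-value : ∀ {t} (w : Word t) → bits t (value w) ≡ w
bits-value []              = refl
bits-value {suc t} (b ∷ w) = cong₂ _∷_ (low-bit b (value w)) (trans (cong (bits t) (high-bits b (value w))) (bits-value w))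
  where
  low-bit : ∀ b k → ((bitValue b + k * 2) % 2 ≡ᵇ 1) ≡ b
  low-bit false k = cong (_≡ᵇ 1) ([m+kn]%n≡m%n 0 k 2)
  low-bit true  k = cong (_≡ᵇ 1) ([m+kn]%n≡m%n 1 k 2)
  high-bits : ∀ b k → (bitValue b + k * 2) / 2 ≡ k
  high-bits false k = trans (+-distrib-/-∣ʳ 0 {d = 2} (divides-refl k)) (m*n/n≡m k 2)
  high-bits true  k = trans (+-distrib-/-∣ʳ 1 {d = 2} (divides-refl k)) (m*n/n≡m k 2)

value-bits : ∀ t k → k < 2 ^ t → value (bits t k) ≡ k
value-bits zero    zero    _          = refl
value-bits zero    (suc k) (s≤s ())
value-bits (suc t) k       k< = begin
  bitValue (k % 2 ≡ᵇ 1) + value (bits t (k / 2)) * 2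
    ≡⟨ cong₂ _+_ (bitValue-parity k) (cong (_* 2) (value-bits t (k / 2) k/2<)) ⟩
  k % 2 + k / 2 * 2
    ≡⟨ m≡m%n+[m/n]*n k 2 ⟨
  k ∎
  where
  open ≡-Reasoning
  k/2< : k / 2 < 2 ^ t
  k/2< = m<n*o⇒m/o<n (subst (k <_) (*-comm 2 (2 ^ t)) k<)
  bitValue-parity : ∀ k → bitValue (k % 2 ≡ᵇ 1) ≡ k % 2
  bitValue-parity k with k % 2 | m%n<n k 2
  ... | 0           | _               = refl
  ... | 1           | _               = refl
  ... | suc (suc _) | s≤s (s≤s ())

bits-zero : ∀ t → bits t 0 ≡ zeros
bits-zero zero    = refl
bits-zero (suc t) = cong (false ∷_) (bits-zero t)

binary : ∀ t {N} → 2 ^ t ≡ N → Fin N ↔ Word t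
binary t {N} 2^t≡N = mk↔ₛ′ (λ k → bits t (toℕ k)) fromWord bits-fromWord fromWord-bits
  where
  fromWord : Word t → Fin N
  fromWord w = fromℕ< (subst (value w <_) 2^t≡N (value<2^ w))
  bits-fromWord : ∀ w → bits t (toℕ (fromWord w)) ≡ w
  bits-fromWord w = trans (cong (bits t) (toℕ-fromℕ< _)) (bits-value w)
  fromWord-bits : ∀ k → fromWord (bits t (toℕ k)) ≡ k
  fromWord-bits k = toℕ-injective
    (trans (toℕ-fromℕ< _) (value-bits t (toℕ k) (subst (toℕ k <_) (sym 2^t≡N) (toℕ<n k))))

binary-zeros : ∀ t {N} (2^t≡1+N : 2 ^ t ≡ suc N) → Inverse.from (binary t 2^t≡1+N) zeros ≡ 0F
binary-zeros t 2^t≡1+N =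
  trans (cong (Inverse.from (binary t 2^t≡1+N)) (sym (bits-zero t))) (Inverse.strictlyInverseʳ (binary t 2^t≡1+N) 0F)

syndrome-lookup : ∀ {n t} (cols : Fin n → Word t) (x : Word n) i →
  lookup (syndrome cols x) i ≡ x · tabulate (λ j → lookup (cols j) i)
syndrome-lookup {zero}  cols []      i = lookup-replicate i false
syndrome-lookup {suc n} cols (b ∷ x) i = begin
  lookup (syndrome cols (b ∷ x)) i
    ≡⟨ lookup-zipWith _xor_ i (map (b ∧_) (cols 0F)) (syndrome (cols ∘ Fin.suc) x) ⟩
  lookup (map (b ∧_) (cols 0F)) i xor lookup (syndrome (cols ∘ Fin.suc) x) i
    ≡⟨ cong₂ _xor_ (lookup-map i (b ∧_) (cols 0F)) (syndrome-lookup (cols ∘ Fin.suc) x i) ⟩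
  (b ∷ x) · tabulate (λ j → lookup (cols j) i) ∎
  where open ≡-Reasoning

hammingRow : ∀ t → Fin t → Word (2 ^ t ∸ 1)
hammingRow t i = tabulate (λ j → lookup (hammingColumn t j) i)

Hamming⇔ : ∀ t x → Hamming t x ⇔ (∀ i → x · hammingRow t i ≡ false)
Hamming⇔ t x = mk⇔
  (λ H i → trans (sym (syndrome-lookup (hammingColumn t) x i))
                 (trans (cong (λ v → lookup v i) H) (lookup-replicate i false)))
  (λ ⊥rows → lookup-extensionality λ i →
    trans (syndrome-lookup (hammingColumn t) x i) (trans (⊥rows i) (sym (lookup-replicate i false))))

-- Coordinate k of H′_t (k = 0 being the parity check) is labelled by the vector bits t k.
values : ∀ t → (Word t → Bool) → Word (suc (2 ^ t ∸ 1))
values t f = tabulate (λ k → f (bits t (toℕ k)))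

coordinateRow : ∀ t → Fin t → Word (suc (2 ^ t ∸ 1))
coordinateRow t i = values t (λ w → lookup w i)

extHammingRow : ∀ t → Fin (suc t) → Word (suc (2 ^ t ∸ 1))
extHammingRow t 0F          = ones
extHammingRow t (Fin.suc i) = coordinateRow t i

xor≡false⇒≡ : ∀ a b → a xor b ≡ false → a ≡ b
xor≡false⇒≡ false false _ = refl
xor≡false⇒≡ true  true  _ = refl

ExtHamming⇔ : ∀ t x → ExtHamming t x ⇔ (∀ i → x · extHammingRow t i ≡ false)
ExtHamming⇔ t (p ∷ x) = mk⇔ to from
  where
  ·-coordinateRow : ∀ i → (p ∷ x) · coordinateRow t i ≡ x · hammingRow t i
  ·-coordinateRow i = cong (_xor (x · hammingRow t i))
    (trans (cong (p ∧_) (trans (cong (λ w → lookup w i) (bits-zero t)) (lookup-replicate i false))) (∧-zeroʳ p))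

  to : ExtHamming t (p ∷ x) → ∀ i → (p ∷ x) · extHammingRow t i ≡ false
  to (H , p≡) 0F          = trans (·-onesʳ (p ∷ x)) (trans (cong (_xor parity x) p≡) (xor-same (parity x)))
  to (H , p≡) (Fin.suc i) = trans (·-coordinateRow i) (Equivalence.to (Hamming⇔ t x) H i)

  from : (∀ i → (p ∷ x) · extHammingRow t i ≡ false) → ExtHamming t (p ∷ x)
  from ⊥rows = Equivalence.from (Hamming⇔ t x) (λ i → trans (sym (·-coordinateRow i)) (⊥rows (Fin.suc i)))
             , xor≡false⇒≡ p (parity x) (trans (sym (·-onesʳ (p ∷ x))) (⊥rows 0F))

-- Square-zero maps on Z₂ᵗ and adapted pairings

-- A shape describes the square-zero map N = nilp s on Z₂ᵗ, whose kernel has dimension r: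
-- every `pair` of coordinates is a Jordan block (b₀, b₁) ↦ (b₁, 0), every `free` one is sent to 0.
data Shape : ℕ → ℕ → Set where
  base : Shape 0 0
  free : ∀ {t r} → Shape t r → Shape (suc t) (suc r)
  pair : ∀ {t r} → Shape t r → Shape (suc (suc t)) (suc r)

nilp : ∀ {t r} → Shape t r → Word t → Word t
nilp base     []            = []
nilp (free s) (b ∷ w)       = false ∷ nilp s w
nilp (pair s) (b₀ ∷ b₁ ∷ w) = b₁ ∷ false ∷ nilp s w

nilp-⊕ : ∀ {t r} (s : Shape t r) (x y : Word t) → nilp s (x ⊕ y) ≡ nilp s x ⊕ nilp s y
nilp-⊕ base     []            []            = refl
nilp-⊕ (free s) (a ∷ x)       (b ∷ y)       = cong (false ∷_) (nilp-⊕ s x y)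
nilp-⊕ (pair s) (a₀ ∷ a₁ ∷ x) (b₀ ∷ b₁ ∷ y) = cong (λ w → (a₁ xor b₁) ∷ false ∷ w) (nilp-⊕ s x y)

nilp-nilp : ∀ {t r} (s : Shape t r) (w : Word t) → nilp s (nilp s w) ≡ zeros
nilp-nilp base     []            = refl
nilp-nilp (free s) (b ∷ w)       = cong (false ∷_) (nilp-nilp s w)
nilp-nilp (pair s) (b₀ ∷ b₁ ∷ w) = cong (λ v → false ∷ false ∷ v) (nilp-nilp s w)

nilp-row : ∀ {t r} (s : Shape t r) (i : Fin t) →
  (∀ w → lookup (nilp s w) i ≡ false) ⊎ ∃ λ j → ∀ w → lookup (nilp s w) i ≡ lookup w j
nilp-row (free s) 0F = inj₁ λ { (b ∷ w) → refl }
nilp-row (free s) (Fin.suc i) with nilp-row s i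
... | inj₁ zero-row       = inj₁ λ { (b ∷ w) → zero-row w }
... | inj₂ (j , unit-row) = inj₂ (Fin.suc j , λ { (b ∷ w) → unit-row w })
nilp-row (pair s) 0F          = inj₂ (1F , λ { (b₀ ∷ b₁ ∷ w) → refl })
nilp-row (pair s) 1F          = inj₁ λ { (b₀ ∷ b₁ ∷ w) → refl }
nilp-row (pair s) (Fin.suc (Fin.suc i)) with nilp-row s i
... | inj₁ zero-row       = inj₁ λ { (b₀ ∷ b₁ ∷ w) → zero-row w }
... | inj₂ (j , unit-row) = inj₂ (Fin.suc (Fin.suc j) , λ { (b₀ ∷ b₁ ∷ w) → unit-row w })

twist : ∀ {t r} → Shape t r → Bool → Word t → Word t
twist s false w = w
twist s true  w = w ⊕ nilp s w

nilp-twist : ∀ {t r} (s : Shape t r) c w → nilp s (twist s c w) ≡ nilp s w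
nilp-twist s false w = refl
nilp-twist s true  w =
  trans (nilp-⊕ s w (nilp s w)) (trans (cong (nilp s w ⊕_) (nilp-nilp s w)) (⊕-identityʳ (nilp s w)))

twist-involutive : ∀ {t r} (s : Shape t r) c w → twist s c (twist s c w) ≡ w
twist-involutive s false w = refl
twist-involutive s true  w = trans (cong ((w ⊕ nilp s w) ⊕_) (nilp-twist s true w)) (⊕-cancelʳ w (nilp s w))

Pairs : ∀ {t r} → Shape t r → Set
Pairs base         = ⊥
Pairs (free s)     = Bool × Pairs s
Pairs (pair {t} s) = (Bool × Pairs s) ⊎ Word t

-- The kernel of N is labelled by Z₂ʳ; the other vectors fall into pairs {v, v + N v}.
record Pairing {t r} (s : Shape t r) : Set where
  field
    split         : Word t → Word r ⊎ (Pairs s × Bool)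
    unsplit       : Word r ⊎ (Pairs s × Bool) → Word t
    split-unsplit : ∀ y → split (unsplit y) ≡ y
    unsplit-split : ∀ w → unsplit (split w) ≡ w
    nilp-kernel   : ∀ k → nilp s (unsplit (inj₁ k)) ≡ zeros
    ⊕-pair        : ∀ q c → unsplit (inj₂ (q , false)) ⊕ unsplit (inj₂ (q , true))
                            ≡ nilp s (unsplit (inj₂ (q , c)))
    split-zeros   : split zeros ≡ inj₁ zeros

  splitting : Word t ↔ (Word r ⊎ (Pairs s × Bool))
  splitting = mk↔ₛ′ split unsplit split-unsplit unsplit-split

basePairing : Pairing base
basePairing = record
  { split         = λ _ → inj₁ []
  ; unsplit       = λ _ → []
  ; split-unsplit = λ { (inj₁ []) → refl ; (inj₂ (() , _)) }
  ; unsplit-split = λ { [] → refl }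
  ; nilp-kernel   = λ _ → refl
  ; ⊕-pair        = λ ()
  ; split-zeros   = refl
  }

module _ {t r} {s : Shape t r} (P : Pairing s) where
  open Pairing P

  consFree : Bool → Word r ⊎ (Pairs s × Bool) → Word (suc r) ⊎ (Pairs (free s) × Bool)
  consFree b (inj₁ k)       = inj₁ (b ∷ k)
  consFree b (inj₂ (q , c)) = inj₂ ((b , q) , c)

  unsplitFree : Word (suc r) ⊎ (Pairs (free s) × Bool) → Word (suc t)
  unsplitFree (inj₁ (b ∷ k))       = b ∷ unsplit (inj₁ k)
  unsplitFree (inj₂ ((b , q) , c)) = b ∷ unsplit (inj₂ (q , c))

  unsplitFree-consFree : ∀ b y → unsplitFree (consFree b y) ≡ b ∷ unsplit y
  unsplitFree-consFree b (inj₁ k) = refl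
  unsplitFree-consFree b (inj₂ y) = refl

  freePairing : Pairing (free s)
  freePairing = record
    { split         = λ { (b ∷ w) → consFree b (split w) }
    ; unsplit       = unsplitFree
    ; split-unsplit = λ { (inj₁ (b ∷ k))       → cong (consFree b) (split-unsplit (inj₁ k))
                        ; (inj₂ ((b , q) , c)) → cong (consFree b) (split-unsplit (inj₂ (q , c))) }
    ; unsplit-split = λ { (b ∷ w) → trans (unsplitFree-consFree b (split w)) (cong (b ∷_) (unsplit-split w)) }
    ; nilp-kernel   = λ { (b ∷ k) → cong (false ∷_) (nilp-kernel k) }
    ; ⊕-pair        = λ { (b , q) c → cong₂ _∷_ (xor-same b) (⊕-pair q c) }
    ; split-zeros   = cong (consFree false) split-zeros
    }

  consPair : Bool → Word r ⊎ (Pairs s × Bool) → Word (suc r) ⊎ (Pairs (pair s) × Bool)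
  consPair b (inj₁ k)       = inj₁ (b ∷ k)
  consPair b (inj₂ (q , c)) = inj₂ (inj₁ (b , q) , c)

  splitPair : Word (suc (suc t)) → Word (suc r) ⊎ (Pairs (pair s) × Bool)
  splitPair (b ∷ false ∷ w) = consPair b (split w)
  splitPair (b ∷ true  ∷ w) = inj₂ (inj₂ (twist s b w) , b)

  unsplitPair : Word (suc r) ⊎ (Pairs (pair s) × Bool) → Word (suc (suc t))
  unsplitPair (inj₁ (b ∷ k))             = b ∷ false ∷ unsplit (inj₁ k)
  unsplitPair (inj₂ (inj₁ (b , q) , c)) = b ∷ false ∷ unsplit (inj₂ (q , c))
  unsplitPair (inj₂ (inj₂ v , c))       = c ∷ true ∷ twist s c v

  unsplitPair-consPair : ∀ b y → unsplitPair (consPair b y) ≡ b ∷ false ∷ unsplit y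
  unsplitPair-consPair b (inj₁ k) = refl
  unsplitPair-consPair b (inj₂ y) = refl

  splitPair-unsplitPair : ∀ y → splitPair (unsplitPair y) ≡ y
  splitPair-unsplitPair (inj₁ (b ∷ k))             = cong (consPair b) (split-unsplit (inj₁ k))
  splitPair-unsplitPair (inj₂ (inj₁ (b , q) , c)) = cong (consPair b) (split-unsplit (inj₂ (q , c)))
  splitPair-unsplitPair (inj₂ (inj₂ v , c))       = cong (λ u → inj₂ (inj₂ u , c)) (twist-involutive s c v)

  unsplitPair-splitPair : ∀ w → unsplitPair (splitPair w) ≡ w
  unsplitPair-splitPair (b ∷ false ∷ w) =
    trans (unsplitPair-consPair b (split w)) (cong (λ u → b ∷ false ∷ u) (unsplit-split w))
  unsplitPair-splitPair (b ∷ true  ∷ w) = cong (λ u → b ∷ true ∷ u) (twist-involutive s b w)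

  ⊕-pairPair : ∀ q c → unsplitPair (inj₂ (q , false)) ⊕ unsplitPair (inj₂ (q , true))
                       ≡ nilp (pair s) (unsplitPair (inj₂ (q , c)))
  ⊕-pairPair (inj₁ (b , q)) c = cong₂ _∷_ (xor-same b) (cong (false ∷_) (⊕-pair q c))
  ⊕-pairPair (inj₂ v)       c =
    cong (λ u → true ∷ false ∷ u) (trans (⊕-cancelˡ v (nilp s v)) (sym (nilp-twist s c v)))

  pairPairing : Pairing (pair s)
  pairPairing = record
    { split         = splitPair
    ; unsplit       = unsplitPair
    ; split-unsplit = splitPair-unsplitPair
    ; unsplit-split = unsplitPair-splitPair
    ; nilp-kernel   = λ { (b ∷ k) → cong (λ u → false ∷ false ∷ u) (nilp-kernel k) }
    ; ⊕-pair        = ⊕-pairPair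
    ; split-zeros   = cong (consPair false) split-zeros
    }

pairing : ∀ {t r} (s : Shape t r) → Pairing s
pairing base     = basePairing
pairing (free s) = freePairing (pairing s)
pairing (pair s) = pairPairing (pairing s)

pairCount : ∀ {t r} → Shape t r → ℕ
pairCount base         = 0
pairCount (free s)     = 2 * pairCount s
pairCount (pair {t} s) = 2 * pairCount s + 2 ^ t

doubled : ∀ {P : Set} {β} → P ↔ Fin β → (Bool × P) ↔ Fin (2 * β)
doubled P↔ = ↔-trans (↔-sym 2↔Bool ×-↔ P↔) (↔-sym *↔×)

pairsFin : ∀ {t r} (s : Shape t r) → Pairs s ↔ Fin (pairCount s)
pairsFin base         = ↔-sym 0↔⊥
pairsFin (free s)     = doubled (pairsFin s)
pairsFin (pair {t} s) = ↔-trans (doubled (pairsFin s) ⊎-↔ ↔-sym (binary t refl)) (↔-sym +↔⊎)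

pairCount-double : ∀ {t r} (s : Shape t r) → 2 * pairCount s + 2 ^ r ≡ 2 ^ t
pairCount-double base = refl
pairCount-double (free {t} {r} s) = begin
  2 * (2 * pairCount s) + 2 * 2 ^ r ≡⟨ *-distribˡ-+ 2 (2 * pairCount s) (2 ^ r) ⟨
  2 * (2 * pairCount s + 2 ^ r)     ≡⟨ cong (2 *_) (pairCount-double s) ⟩
  2 * 2 ^ t                         ∎
  where open ≡-Reasoning
pairCount-double (pair {t} {r} s) = begin
  2 * (2 * pairCount s + 2 ^ t) + 2 * 2 ^ r ≡⟨ solve 3 (λ b x y → con 2 :* (con 2 :* b :+ x) :+ con 2 :* y
                                                          := con 2 :* ((con 2 :* b :+ y) :+ x)) refl (pairCount s) (2 ^ t) (2 ^ r) ⟩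
  2 * ((2 * pairCount s + 2 ^ r) + 2 ^ t)   ≡⟨ cong (λ z → 2 * (z + 2 ^ t)) (pairCount-double s) ⟩
  2 * (2 ^ t + 2 ^ t)                       ≡⟨ cong (2 *_) (cong (2 ^ t +_) (+-identityʳ (2 ^ t))) ⟨
  2 * (2 * 2 ^ t)                           ∎
  where open ≡-Reasoning

2*m+2*n≡2*o⇒m≡o∸n : ∀ m n o → 2 * m + 2 * n ≡ 2 * o → m ≡ o ∸ n
2*m+2*n≡2*o⇒m≡o∸n m n o eq =
  trans (sym (m+n∸n≡m m n)) (cong (_∸ n) (*-cancelˡ-≡ (m + n) o 2 (trans (*-distribˡ-+ 2 m n) eq)))

pairCount≡ : ∀ {t r} (s : Shape t r) → pairCount s ≡ 2 ^ (t ∸ 1) ∸ 2 ^ (r ∸ 1)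
pairCount≡ base                 = refl
pairCount≡ s@(free {t} {r} _)   = 2*m+2*n≡2*o⇒m≡o∸n (pairCount s) (2 ^ r) (2 ^ t) (pairCount-double s)
pairCount≡ s@(pair {t} {r} _)   = 2*m+2*n≡2*o⇒m≡o∸n (pairCount s) (2 ^ r) (2 ^ suc t) (pairCount-double s)

shape : ∀ {t r} → r ≤ t → t ≤ 2 * r → Shape t r
shape {zero}  {zero}  _ _ = base
shape {suc t} {zero}  _ ()
shape {suc t} {suc r} (s≤s r≤t) t≤2r with m≤n⇒m<n∨m≡n r≤t
... | inj₂ refl          = free (shape ≤-refl (m≤m+n t (t + 0)))
... | inj₁ (s≤s r≤t′)    = pair (shape r≤t′ (s≤s⁻¹ (≤-trans (s≤s⁻¹ t≤2r) (≤-reflexive (+-suc r (r + 0))))))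

grayIndex : ∀ {K Q : Set} {α β} → K ↔ Fin α → Q ↔ Fin β → (K ⊎ (Q × Bool)) ↔ Fin (α + β * 2)
grayIndex K↔ Q↔ = ↔-trans (K↔ ⊎-↔ ↔-trans (Q↔ ×-↔ ↔-sym 2↔Bool) (↔-sym *↔×)) (↔-sym +↔⊎)

pairDiff : ∀ {K Q : Set} → (K ⊎ (Q × Bool) → Bool) → K ⊎ (Q × Bool) → Bool
pairDiff g (inj₁ _)       = false
pairDiff g (inj₂ (q , _)) = g (inj₂ (q , false)) xor g (inj₂ (q , true))

uMul-tabulate : ∀ {K Q : Set} {α β} (K↔ : K ↔ Fin α) (Q↔ : Q ↔ Fin β) (g : K ⊎ (Q × Bool) → Bool) →
  uMul α β (tabulate (g ∘ Inverse.from (grayIndex K↔ Q↔)))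
    ≡ tabulate (pairDiff g ∘ Inverse.from (grayIndex K↔ Q↔))
uMul-tabulate {K} {Q} {α} {β} K↔ Q↔ g = lookup-extensionality λ p → begin
  lookup (uMul α β T) p            ≡⟨ cong (lookup (uMul α β T)) (Inverse.strictlyInverseˡ E p) ⟨
  lookup (uMul α β T) (to (from p)) ≡⟨ at-index (from p) ⟩
  pairDiff g (from p)              ≡⟨ lookup∘tabulate (pairDiff g ∘ from) p ⟨
  lookup (tabulate (pairDiff g ∘ from)) p ∎
  where
  open ≡-Reasoning
  E : (K ⊎ (Q × Bool)) ↔ Fin (α + β * 2)
  E = grayIndex K↔ Q↔
  open Inverse E using (to; from)
  T : Word (α + β * 2)
  T = tabulate (g ∘ from)

  lookup-T : ∀ y → lookup T (to y) ≡ g y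
  lookup-T y = trans (lookup∘tabulate (g ∘ from) (to y)) (cong g (Inverse.strictlyInverseʳ E y))

  at-index : ∀ y → lookup (uMul α β T) (to y) ≡ pairDiff g y
  at-index (inj₁ k)       = lookup-uMul-↑ˡ α β T (Inverse.to K↔ k)
  at-index (inj₂ (q , c)) = trans (lookup-uMul-↑ʳ α β T (Inverse.to Q↔ q) (Inverse.from 2↔Bool c))
                                  (cong₂ _xor_ (lookup-T (inj₂ (q , false))) (lookup-T (inj₂ (q , true))))

-- Hamming codes in Gray coordinates

2^n≡1+[2^n∸1] : ∀ n → 2 ^ n ≡ suc (2 ^ n ∸ 1)
2^n≡1+[2^n∸1] n = sym (suc-pred (2 ^ n) {{m^n≢0 2 n}})

module HammingConstruction {t r} (s : Shape t r) {a β} (2^r≡1+a : 2 ^ r ≡ suc a) (pairCount≡β : pairCount s ≡ β) where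

  open Pairing (pairing s)

  kernelFin : Word r ↔ Fin (suc a)
  kernelFin = ↔-sym (binary r 2^r≡1+a)

  pairsFin′ : Pairs s ↔ Fin β
  pairsFin′ = subst (λ b → Pairs s ↔ Fin b) pairCount≡β (pairsFin s)

  gray : (Word r ⊎ (Pairs s × Bool)) ↔ Fin (suc a + β * 2)
  gray = grayIndex kernelFin pairsFin′

  coordinates : Fin (suc (2 ^ t ∸ 1)) ↔ Word t
  coordinates = binary t (2^n≡1+[2^n∸1] t)

  σ : Permutation (suc (2 ^ t ∸ 1)) (suc a + β * 2)
  σ = ↔-trans coordinates (↔-trans splitting gray)

  open UStability (suc a) β σ

  permute-values : ∀ f → permute σ (values t f) ≡ tabulate (f ∘ unsplit ∘ Inverse.from gray)
  permute-values f = tabulate-cong λ p →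
    trans (lookup∘tabulate (λ k → f (bits t (toℕ k))) (σ ⟨$⟩ˡ p))
          (cong f (Inverse.strictlyInverseˡ coordinates (unsplit (Inverse.from gray p))))

  U-values : ∀ f h → (∀ y → pairDiff (f ∘ unsplit) y ≡ h (unsplit y)) → U (values t f) ≡ values t h
  U-values f h pairDiff≡h = begin
    permute (flip σ) (uMul (suc a) β (permute σ (values t f)))
      ≡⟨ cong (permute (flip σ) ∘ uMul (suc a) β) (permute-values f) ⟩
    permute (flip σ) (uMul (suc a) β (tabulate (f ∘ unsplit ∘ Inverse.from gray)))
      ≡⟨ cong (permute (flip σ)) (uMul-tabulate kernelFin pairsFin′ (f ∘ unsplit)) ⟩
    permute (flip σ) (tabulate (pairDiff (f ∘ unsplit) ∘ Inverse.from gray))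
      ≡⟨ cong (permute (flip σ)) (trans (tabulate-cong (pairDiff≡h ∘ Inverse.from gray)) (sym (permute-values h))) ⟩
    permute (flip σ) (permute σ (values t h))
      ≡⟨ permute-inverseˡ σ (values t h) ⟩
    values t h ∎
    where open ≡-Reasoning

  U-ones : U ones ≡ zeros
  U-ones = begin
    U ones                       ≡⟨ cong U (tabulate-const true) ⟨
    U (values t (λ _ → true))    ≡⟨ U-values _ _ (λ { (inj₁ _) → refl ; (inj₂ _) → refl }) ⟩
    values t (λ _ → false)       ≡⟨ tabulate-const false ⟩
    zeros                        ∎
    where open ≡-Reasoning

  U-coordinateRow : ∀ i → U (coordinateRow t i) ≡ values t (λ w → lookup (nilp s w) i)
  U-coordinateRow i = U-values (λ w → lookup w i) (λ w → lookup (nilp s w) i) λ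
    { (inj₁ k)       → sym (trans (cong (λ v → lookup v i) (nilp-kernel k)) (lookup-replicate i false))
    ; (inj₂ (q , c)) → trans (sym (lookup-zipWith _xor_ i (unsplit (inj₂ (q , false))) (unsplit (inj₂ (q , true)))))
                             (cong (λ v → lookup v i) (⊕-pair q c))
    }

  U-coordinateRow-cases : ∀ i →
    U (coordinateRow t i) ≡ zeros ⊎ ∃ λ j → U (coordinateRow t i) ≡ coordinateRow t j
  U-coordinateRow-cases i with nilp-row s i
  ... | inj₁ zero-row       =
    inj₁ (trans (U-coordinateRow i) (trans (tabulate-cong λ k → zero-row (bits t (toℕ k))) (tabulate-const false)))
  ... | inj₂ (j , unit-row) =
    inj₂ (j , trans (U-coordinateRow i) (tabulate-cong λ k → unit-row (bits t (toℕ k))))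

  U-extHammingRow : ∀ i →
    U (extHammingRow t i) ≡ zeros ⊎ ∃ λ j → U (extHammingRow t i) ≡ extHammingRow t j
  U-extHammingRow 0F = inj₁ U-ones
  U-extHammingRow (Fin.suc i) with U-coordinateRow-cases i
  ... | inj₁ eq       = inj₁ eq
  ... | inj₂ (j , eq) = inj₂ (Fin.suc j , eq)

  extHamming-stable : IsUStable (ExtHamming t)
  extHamming-stable = IsUStable-kernel (extHammingRow t) (ExtHamming⇔ t) U-extHammingRow

  -- The zero vector labels coordinate 0 and lies in ker N, so σ fixes 0 and removing it
  -- leaves coordinates for H_t.
  σ-0 : σ ⟨$⟩ʳ 0F ≡ 0F
  σ-0 = begin
    Inverse.to gray (split (bits t 0)) ≡⟨ cong (Inverse.to gray ∘ split) (bits-zero t) ⟩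
    Inverse.to gray (split zeros)      ≡⟨ cong (Inverse.to gray) split-zeros ⟩
    Inverse.to gray (inj₁ zeros)       ≡⟨ cong (_↑ˡ β * 2) (binary-zeros r 2^r≡1+a) ⟩
    0F                              ∎
    where open ≡-Reasoning

  module Punctured = UStability a β (remove 0F σ)

  U-cons : ∀ b x → U (b ∷ x) ≡ false ∷ Punctured.U x
  U-cons b x = trans (cong (permute (flip σ) ∘ uMul (suc a) β) (permute-remove σ σ-0 b x))
                     (permute-flip-remove σ σ-0 false _)

  U-hammingRow : ∀ i →
    Punctured.U (hammingRow t i) ≡ zeros ⊎ ∃ λ j → Punctured.U (hammingRow t i) ≡ hammingRow t j
  U-hammingRow i with U-coordinateRow-cases i
  ... | inj₁ eq       = inj₁ (∷-injectiveʳ (trans (sym (U-cons _ (hammingRow t i))) eq))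
  ... | inj₂ (j , eq) = inj₂ (j , ∷-injectiveʳ (trans (sym (U-cons _ (hammingRow t i))) eq))

  hamming-stable : Punctured.IsUStable (Hamming t)
  hamming-stable = Punctured.IsUStable-kernel (hammingRow t) (Hamming⇔ t) U-hammingRow

  extHamming-linear : IsZ2Z2uLinear (ExtHamming t) (suc a) β
  extHamming-linear = IsUStable⇒IsZ2Z2uLinear extHamming-stable

  simplex-linear : IsZ2Z2uLinear (Dual (Hamming t)) a β
  simplex-linear = Punctured.IsUStable⇒IsZ2Z2uLinear (Punctured.IsUStable-Dual hamming-stable)

  hadamard-linear : IsZ2Z2uLinear (Dual (ExtHamming t)) (suc a) β
  hadamard-linear = IsUStable⇒IsZ2Z2uLinear (IsUStable-Dual extHamming-stable)

corollary3 : (t r : ℕ) → 3 ≤ t → t ≤ 2 * r → r ≤ t →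
    IsZ2Z2uLinear (ExtHamming t) (2 ^ r) (2 ^ (t ∸ 1) ∸ 2 ^ (r ∸ 1))
    × IsZ2Z2uLinear (Dual (Hamming t)) (2 ^ r ∸ 1) (2 ^ (t ∸ 1) ∸ 2 ^ (r ∸ 1))
    × IsZ2Z2uLinear (Dual (ExtHamming t)) (2 ^ r) (2 ^ (t ∸ 1) ∸ 2 ^ (r ∸ 1))
corollary3 t r _ t≤2r r≤t =
    subst (λ α → IsZ2Z2uLinear (ExtHamming t) α pairs) (sym 2^r≡) extHamming-linear
  , simplex-linear
  , subst (λ α → IsZ2Z2uLinear (Dual (ExtHamming t)) α pairs) (sym 2^r≡) hadamard-linear
  where
  pairs : ℕ
  pairs = 2 ^ (t ∸ 1) ∸ 2 ^ (r ∸ 1)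
  2^r≡ : 2 ^ r ≡ suc (2 ^ r ∸ 1)
  2^r≡ = 2^n≡1+[2^n∸1] r
  s : Shape t r
  s = shape r≤t t≤2r
  open HammingConstruction s 2^r≡ (pairCount≡ s)
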